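{- For every instance, every work-conserving schedule $\mathcal{S}$ and every $t\in\mathbb{N}$, the map $q_{t,\mathcal{SRPT}}$ majorizes the map $q_{t,\mathcal{S}}$ (both with domain $\{1,\dots,n\}$).
   Context: A single machine and $n$ jobs; job $J_i$ has integer release time $r_i\ge0$ and integer processing time $p_i\ge1$. Unit slots $[t]=[t,t+1)$, $t\in\mathbb{N}$. A schedule assigns each slot to at most one job, $J_i$ receiving exactly $p_i$ slots all with $t\ge r_i$; $c_i(\mathcal{S})$ is $1$ plus the last slot of $J_i$. $J_i$ is active at $t$ if $r_i\le t<c_i(\mathcal{S})$; $q_{t,\mathcal{S}}(i)$ is $p_i$ minus the number of slots before $t$ assigned to $J_i$ if $J_i$ is active, and $0$ otherwise. A schedule is work-conserving if for every $t$, whenever some job is active at $t$, slot $[t]$ is assigned to some job. $\mathcal{SRPT}$ is a schedule that in every slot $[t]$ executes an active job with the smallest remaining processing time $q_{t,\mathcal{SRPT}}(i)$ (ties broken arbitrarily). A map is a non-negative function with a finite domain. For a map $f$, $S(f)=\sum_{x\in\mathrm{dom} f}f(x)$; listing $\mathrm{dom} f$ in non-increasing order of $f$-values as $\pi_f(1),\dots,\pi_f(|\mathrm{dom} f|)$, set $S_0(f)=0$, $S_k(f)=\sum_{j=1}^{k}f(\pi_f(j))$ for $1\le k\le|\mathrm{dom} f|$ and $S_k(f)=S(f)$ for $k>|\mathrm{dom} f|$. A map $f$ majorizes a map $g$ if $S(f)=S(g)$ and $S_k(f)\ge S_k(g)$ for all $k\in\mathbb{N}$. -}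

module Defs where

open import Data.Nat using (ℕ; zero; suc; _+_; _∸_; _≤_; _<_; _≤?_)
open import Data.Nat.Properties using (≤-decTotalOrder)
open import Data.Fin using (Fin; _≟_)
open import Data.Maybe using (Maybe; just; nothing)
open import Data.List using (List; map; take; allFin)
open import Data.Nat.ListAction using (sum)
open import Data.Product using (Σ; ∃; _×_; _,_)
open import Relation.Nullary using (¬_; yes; no)
open import Relation.Binary.PropositionalEquality using (_≡_; _≢_)
open import Relation.Binary.Properties.DecTotalOrder ≤-decTotalOrder using (≥-decTotalOrder)
import Data.List.Sort.InsertionSort as InsSort

S : ∀ {n} → (Fin n → ℕ) → ℕ
S {n} f = sum (map f (allFin n))

sortedDesc : ∀ {n} → (Fin n → ℕ) → List ℕ
sortedDesc {n} f = InsSort.sort ≥-decTotalOrder (map f (allFin n))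

-- S_k(f) : sum of the k largest values (= S(f) when k > |dom f|, 0 when k = 0)
Sk : ∀ {n} → ℕ → (Fin n → ℕ) → ℕ
Sk k f = sum (take k (sortedDesc f))

Majorizes : ∀ {n} → (Fin n → ℕ) → (Fin n → ℕ) → Set
Majorizes f g = (S f ≡ S g) × (∀ (k : ℕ) → Sk k g ≤ Sk k f)

record Instance (n : ℕ) : Set where
  field
    r : Fin n → ℕ
    p : Fin n → ℕ
    p≥1 : ∀ i → 1 ≤ p i

countBelow : ∀ {n} → (ℕ → Maybe (Fin n)) → Fin n → ℕ → ℕ
countBelow σ i zero = zero
countBelow σ i (suc k) with σ k
... | nothing = countBelow σ i k
... | just j with j ≟ i
...   | yes _ = suc (countBelow σ i k)
...   | no  _ = countBelow σ i k

lastPlusOneBelow : ∀ {n} → (ℕ → Maybe (Fin n)) → Fin n → ℕ → ℕ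
lastPlusOneBelow σ i zero = zero
lastPlusOneBelow σ i (suc k) with σ k
... | nothing = lastPlusOneBelow σ i k
... | just j with j ≟ i
...   | yes _ = suc k
...   | no  _ = lastPlusOneBelow σ i k

-- Since the total
-- work is finite, all assigned slots lie below some horizon T.
record Schedule {n : ℕ} (I : Instance n) : Set where
  open Instance I
  field
    σ       : ℕ → Maybe (Fin n)
    horizon : ℕ
    idle    : ∀ t → horizon ≤ t → σ t ≡ nothing
    release : ∀ t i → σ t ≡ just i → r i ≤ t
    amount  : ∀ i → countBelow σ i horizon ≡ p i

module _ {n : ℕ} {I : Instance n} (𝒮 : Schedule I) where
  open Instance I
  open Schedule 𝒮

  -- completion time c_i(S) = 1 + last slot of J_i
  c : Fin n → ℕ
  c i = lastPlusOneBelow σ i horizon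

  Active : Fin n → ℕ → Set
  Active i t = (r i ≤ t) × (t < c i)

  q : ℕ → Fin n → ℕ
  q t i with r i ≤? t | suc t ≤? c i
  ... | yes _ | yes _ = p i ∸ countBelow σ i t
  ... | _     | _     = 0

  WorkConserving : Set
  WorkConserving = ∀ t → (∃ λ i → Active i t) → σ t ≢ nothing

  IsSRPT : Set
  IsSRPT = WorkConserving ×
           (∀ t i → σ t ≡ just i → Active i t × (∀ j → Active j t → q t i ≤ q t j))

-- Compare the remaining-work vectors, f of SRPT and g of the other schedule, through their
-- threshold excesses E_a(h) = Σᵢ (hᵢ ∸ a).  In a non-increasing list the k largest entries sum to min_a (k·a + E_a), so equal totals
-- and E_a(g) ≤ E_a(f) for every a (written f ≽ g) imply that f majorizes g.  Both schedules
-- see the same arrivals, which add the same amount to every E_a, so it suffices that one slot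
-- of processing preserves f ≽ g.  Serving job j lowers E_a by one exactly when a < hⱼ; the
-- only threshold at risk is one with g_{j′} ≤ a < f_j, where f_j, the job served by SRPT, is
-- the smallest positive entry of f.  There E_a(g) < E_a(f): if at most as many entries of f as
-- of g exceed a, then Σf = E_a(f) + a·N_a(f) while Σg > E_a(g) + a·N_a(g), as g_{j′} counts
-- in neither; otherwise E_a = E_{a+1} + N_a turns the inequality at a + 1 into a strict one.

module Submission where

open import Defs
open import Data.Fin using (Fin; zero; suc; _≟_)
open import Data.List using ([]; _∷_; map; take; tabulate; allFin)
open import Data.List.Properties using (map-tabulate; map-∘; take-[])
open import Data.List.Relation.Binary.Permutation.Propositional.Properties using (map⁺)
open import Data.List.Relation.Unary.All using (All; []; _∷_)
open import Data.List.Relation.Unary.AllPairs using (AllPairs; []; _∷_)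
open import Data.List.Relation.Unary.Linked.Properties using (Linked⇒AllPairs)
open import Data.Maybe using (Maybe; just; nothing)
open import Data.Nat
  using (ℕ; zero; suc; _+_; _*_; _∸_; _≤_; _<_; _≥_; _≰_; z≤n; s≤s; s<s; z<s; _≤?_; _<?_; _≤′_; ≤′-refl; ≤′-step)
  renaming (_≟_ to _≟ℕ_)
open import Data.Nat.ListAction using (sum)
open import Data.Nat.ListAction.Properties using (sum-↭)
open import Data.Nat.Properties hiding (_≟_)
open import Algebra.Properties.CommutativeSemigroup +-commutativeSemigroup using (interchange)
open import Data.Product using (_×_; _,_; proj₁; proj₂; ∃-syntax)
open import Data.Sum using (inj₁; inj₂)
open import Function using (_∘_; id)
open import Relation.Binary.PropositionalEquality
open import Relation.Binary.Properties.DecTotalOrder ≤-decTotalOrder using (≥-decTotalOrder)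
open import Relation.Binary.Definitions using (tri<; tri≈; tri>)
open import Relation.Nullary using (yes; no; contradiction)
import Data.List.Sort.InsertionSort.Properties ≥-decTotalOrder as InsertionSort
open import Algebra.Properties.Semiring.Sum +-*-semiring
  using (sum-cong-≗; sum-replicate-zero; ∑-distrib-+; *-distribˡ-sum) renaming (sum to ∑)

∸-comm : ∀ m n o → m ∸ n ∸ o ≡ m ∸ o ∸ n
∸-comm m n o = trans (∸-+-assoc m n o) (trans (cong (m ∸_) (+-comm n o)) (sym (∸-+-assoc m o n)))

m≡0⇒m∸n≡0 : ∀ {m} n → m ≡ 0 → m ∸ n ≡ 0
m≡0⇒m∸n≡0 n refl = 0∸n≡0 n

∑-mono : ∀ {n} {u h : Fin n → ℕ} → (∀ i → u i ≤ h i) → ∑ u ≤ ∑ h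
∑-mono {zero}  u≤h = z≤n
∑-mono {suc n} u≤h = +-mono-≤ (u≤h zero) (∑-mono (u≤h ∘ suc))

∑-mono-< : ∀ {n} {u h : Fin n → ℕ} j → (∀ i → u i ≤ h i) → u j < h j → ∑ u < ∑ h
∑-mono-< zero    u≤h uj<hj = +-mono-<-≤ uj<hj (∑-mono (u≤h ∘ suc))
∑-mono-< (suc j) u≤h uj<hj = +-mono-≤-< (u≤h zero) (∑-mono-< j (u≤h ∘ suc) uj<hj)

∑-zero : ∀ {n} {h : Fin n → ℕ} → (∀ i → h i ≡ 0) → ∑ h ≡ 0
∑-zero {n} h≗0 = trans (sum-cong-≗ h≗0) (sum-replicate-zero n)

δ : ∀ {n} → Fin n → Fin n → ℕ
δ zero    zero    = 1
δ zero    (suc _) = 0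
δ (suc _) zero    = 0
δ (suc j) (suc i) = δ j i

δ-self : ∀ {n} (i : Fin n) → δ i i ≡ 1
δ-self zero    = refl
δ-self (suc i) = δ-self i

δ-≢ : ∀ {n} {j i : Fin n} → j ≢ i → δ j i ≡ 0
δ-≢ {j = zero}  {zero}  j≢i = contradiction refl j≢i
δ-≢ {j = zero}  {suc i} _   = refl
δ-≢ {j = suc j} {zero}  _   = refl
δ-≢ {j = suc j} {suc i} j≢i = δ-≢ (j≢i ∘ cong suc)

decrementAt : ∀ {n} → Fin n → (Fin n → ℕ) → Fin n → ℕ
decrementAt j h i = h i ∸ δ j i

∑-decrementAt : ∀ {n} (h : Fin n → ℕ) j → 0 < h j → ∑ h ≡ suc (∑ (decrementAt j h))
∑-decrementAt h zero    0<h0 = cong (_+ ∑ (h ∘ suc)) (sym (m+[n∸m]≡n 0<h0))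
∑-decrementAt h (suc j) 0<hj =
  trans (cong (h zero +_) (∑-decrementAt (h ∘ suc) j 0<hj)) (+-suc (h zero) _)

∑-decrementAt-zero : ∀ {n} (h : Fin n → ℕ) j → h j ≡ 0 → ∑ (decrementAt j h) ≡ ∑ h
∑-decrementAt-zero h zero    h0≡0 = cong (_+ ∑ (h ∘ suc)) (trans (cong (_∸ 1) h0≡0) (sym h0≡0))
∑-decrementAt-zero h (suc j) hj≡0 = cong (h zero +_) (∑-decrementAt-zero (h ∘ suc) j hj≡0)

-- Threshold excess and dominance

excess : ∀ {n} → ℕ → (Fin n → ℕ) → ℕ
excess a h = ∑ (λ i → h i ∸ a)

excess-decrementAt : ∀ {n} a (h : Fin n → ℕ) j →
                     excess a (decrementAt j h) ≡ ∑ (decrementAt j (λ i → h i ∸ a))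
excess-decrementAt a h j = sum-cong-≗ (λ i → ∸-comm (h i) (δ j i) a)

excess-decrementAt-above : ∀ {n} {a} (h : Fin n → ℕ) j → a < h j →
                           excess a h ≡ suc (excess a (decrementAt j h))
excess-decrementAt-above {a = a} h j a<hj =
  trans (∑-decrementAt (λ i → h i ∸ a) j (m<n⇒0<n∸m a<hj)) (cong suc (sym (excess-decrementAt a h j)))

excess-decrementAt-below : ∀ {n} {a} (h : Fin n → ℕ) j → h j ≤ a →
                           excess a (decrementAt j h) ≡ excess a h
excess-decrementAt-below {a = a} h j hj≤a =
  trans (excess-decrementAt a h j) (∑-decrementAt-zero (λ i → h i ∸ a) j (m≤n⇒m∸n≡0 hj≤a))

excess-decrementAt-≤ : ∀ {n} a (h : Fin n → ℕ) j → excess a (decrementAt j h) ≤ excess a h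
excess-decrementAt-≤ a h j = ∑-mono (λ i → ∸-monoˡ-≤ a (m∸n≤m (h i) (δ j i)))

above : ℕ → ℕ → ℕ
above a       zero    = 0
above zero    (suc x) = 1
above (suc a) (suc x) = above a x

above-< : ∀ {a x} → a < x → above a x ≡ 1
above-< {zero}  {suc x} _         = refl
above-< {suc a} {suc x} (s<s a<x) = above-< a<x

above-≥ : ∀ {a x} → x ≤ a → above a x ≡ 0
above-≥ z≤n                 = refl
above-≥ {suc a} (s≤s x≤a) = above-≥ x≤a

countAbove : ∀ {n} → ℕ → (Fin n → ℕ) → ℕ
countAbove a h = ∑ (λ i → above a (h i))

∸-suc-above : ∀ a x → x ∸ a ≡ x ∸ suc a + above a x
∸-suc-above zero    zero    = refl
∸-suc-above (suc a) zero    = refl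
∸-suc-above zero    (suc x) = +-comm 1 x
∸-suc-above (suc a) (suc x) = ∸-suc-above a x

excess-suc : ∀ {n} a (h : Fin n → ℕ) → excess a h ≡ excess (suc a) h + countAbove a h
excess-suc a h =
  trans (sum-cong-≗ (λ i → ∸-suc-above a (h i))) (∑-distrib-+ (λ i → h i ∸ suc a) (λ i → above a (h i)))

keepAbove : ℕ → ℕ → ℕ
keepAbove a x = x ∸ a + a * above a x

keepAbove-< : ∀ {a x} → a < x → keepAbove a x ≡ x
keepAbove-< {a} {x} a<x = begin
  x ∸ a + a * above a x ≡⟨ cong (λ b → x ∸ a + a * b) (above-< a<x) ⟩
  x ∸ a + a * 1         ≡⟨ cong (x ∸ a +_) (*-identityʳ a) ⟩
  x ∸ a + a             ≡⟨ m∸n+n≡m (<⇒≤ a<x) ⟩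
  x                     ∎
  where open ≡-Reasoning

keepAbove-≥ : ∀ {a x} → x ≤ a → keepAbove a x ≡ 0
keepAbove-≥ {a} x≤a = cong₂ _+_ (m≤n⇒m∸n≡0 x≤a) (trans (cong (a *_) (above-≥ x≤a)) (*-zeroʳ a))

keepAbove-≤ : ∀ a x → keepAbove a x ≤ x
keepAbove-≤ a x with a <? x
... | yes a<x = ≤-reflexive (keepAbove-< a<x)
... | no  a≮x = ≤-trans (≤-reflexive (keepAbove-≥ (≮⇒≥ a≮x))) z≤n

∑-keepAbove : ∀ {n} a (h : Fin n → ℕ) → ∑ (λ i → keepAbove a (h i)) ≡ excess a h + a * countAbove a h
∑-keepAbove a h = trans (∑-distrib-+ (λ i → h i ∸ a) (λ i → a * above a (h i)))
                        (cong (excess a h +_) (sym (*-distribˡ-sum a (λ i → above a (h i)))))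

infix 4 _≽_

record _≽_ {n} (f g : Fin n → ℕ) : Set where
  constructor dominates
  field
    ∑-≡      : ∑ f ≡ ∑ g
    excess-≤ : ∀ a → excess a g ≤ excess a f

open _≽_ public

≽-resp-≗ : ∀ {n} {f f′ g g′ : Fin n → ℕ} → f ≗ f′ → g ≗ g′ → f′ ≽ g′ → f ≽ g
≽-resp-≗ f≗f′ g≗g′ (dominates ∑f′≡∑g′ g′≼f′) = dominates
  (trans (sum-cong-≗ f≗f′) (trans ∑f′≡∑g′ (sym (sum-cong-≗ g≗g′))))
  (λ a → subst₂ _≤_ (excess-cong a g≗g′) (excess-cong a f≗f′) (g′≼f′ a))
  where
  excess-cong : ∀ {n} a {h h′ : Fin n → ℕ} → h ≗ h′ → excess a h′ ≡ excess a h
  excess-cong a h≗h′ = sym (sum-cong-≗ (λ i → cong (_∸ a) (h≗h′ i)))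

≽-+-excess : ∀ {n} {f f₁ g g₁ : Fin n → ℕ} (e : Fin n → ℕ) →
             (∀ a → excess a f₁ ≡ excess a f + excess a e) →
             (∀ a → excess a g₁ ≡ excess a g + excess a e) →
             f ≽ g → f₁ ≽ g₁
≽-+-excess e f₁≡ g₁≡ (dominates ∑f≡∑g g≼f) = dominates
  (trans (f₁≡ 0) (trans (cong (_+ ∑ e) ∑f≡∑g) (sym (g₁≡ 0))))
  (λ a → subst₂ _≤_ (sym (g₁≡ a)) (sym (f₁≡ a)) (+-monoˡ-≤ (excess a e) (g≼f a)))

module _ {n} {f g : Fin n → ℕ} {j j′ : Fin n}
         (f≽g : f ≽ g) (f-min : ∀ k → 0 < f k → f j ≤ f k) (0<gj′ : 0 < g j′) where

  excess-<-between : ∀ {a} → g j′ ≤ a → a < f j → excess a g < excess a f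
  excess-<-between {a} gj′≤a a<fj with countAbove a f ≤? countAbove a g
  ... | yes Nf≤Ng = +-cancelʳ-< (a * countAbove a f) _ _ (begin-strict
    excess a g + a * countAbove a f  ≤⟨ +-monoʳ-≤ (excess a g) (*-monoʳ-≤ a Nf≤Ng) ⟩
    excess a g + a * countAbove a g  ≡⟨ ∑-keepAbove a g ⟨
    ∑ (λ i → keepAbove a (g i))      <⟨ ∑-mono-< j′ (λ i → keepAbove-≤ a (g i)) keep-gj′<gj′ ⟩
    ∑ g                              ≡⟨ ∑-≡ f≽g ⟨
    ∑ f                              ≡⟨ sum-cong-≗ keep-f ⟨
    ∑ (λ i → keepAbove a (f i))      ≡⟨ ∑-keepAbove a f ⟩
    excess a f + a * countAbove a f  ∎)
    where
    open ≤-Reasoning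
    keep-gj′<gj′ : keepAbove a (g j′) < g j′
    keep-gj′<gj′ = ≤-<-trans (≤-reflexive (keepAbove-≥ gj′≤a)) 0<gj′
    keep-f : ∀ k → keepAbove a (f k) ≡ f k
    keep-f k with 0 <? f k
    ... | yes 0<fk = keepAbove-< (<-≤-trans a<fj (f-min k 0<fk))
    ... | no  0≮fk = trans (keepAbove-≥ {a} (≤-trans fk≤0 z≤n)) (sym (n≤0⇒n≡0 fk≤0))
      where fk≤0 = ≮⇒≥ 0≮fk
  ... | no Nf≰Ng = begin-strict
    excess a g                            ≡⟨ excess-suc a g ⟩
    excess (suc a) g + countAbove a g     <⟨ +-mono-≤-< (excess-≤ f≽g (suc a)) (≰⇒> Nf≰Ng) ⟩
    excess (suc a) f + countAbove a f     ≡⟨ excess-suc a f ⟨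
    excess a f                            ∎
    where open ≤-Reasoning

  decrementAt-≽ : 0 < f j → decrementAt j f ≽ decrementAt j′ g
  decrementAt-≽ 0<fj = dominates
    (suc-injective (trans (sym (∑-decrementAt f j 0<fj)) (trans (∑-≡ f≽g) (∑-decrementAt g j′ 0<gj′))))
    decremented-excess-≤
    where
    open ≤-Reasoning
    decremented-excess-≤ : ∀ a → excess a (decrementAt j′ g) ≤ excess a (decrementAt j f)
    decremented-excess-≤ a with a <? f j | a <? g j′
    ... | no a≮fj | _ = begin
      excess a (decrementAt j′ g)  ≤⟨ excess-decrementAt-≤ a g j′ ⟩
      excess a g                   ≤⟨ excess-≤ f≽g a ⟩
      excess a f                   ≡⟨ excess-decrementAt-below f j (≮⇒≥ a≮fj) ⟨
      excess a (decrementAt j f)   ∎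
    ... | yes a<fj | yes a<gj′ =
      ≤-pred (subst₂ _≤_ (excess-decrementAt-above g j′ a<gj′) (excess-decrementAt-above f j a<fj)
                         (excess-≤ f≽g a))
    ... | yes a<fj | no a≮gj′ = ≤-pred (begin
      suc (excess a (decrementAt j′ g))  ≤⟨ s≤s (excess-decrementAt-≤ a g j′) ⟩
      suc (excess a g)                   ≤⟨ excess-<-between (≮⇒≥ a≮gj′) a<fj ⟩
      excess a f                         ≡⟨ excess-decrementAt-above f j a<fj ⟩
      suc (excess a (decrementAt j f))   ∎)

-- Majorization

sum-tabulate : ∀ {n} (h : Fin n → ℕ) → sum (tabulate h) ≡ ∑ h
sum-tabulate {zero}  h = refl
sum-tabulate {suc n} h = cong (h zero +_) (sum-tabulate (h ∘ suc))

sum-map-allFin : ∀ {n} (h : Fin n → ℕ) → sum (map h (allFin n)) ≡ ∑ h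
sum-map-allFin h = trans (cong sum (map-tabulate id h)) (sum-tabulate h)

sum-∸-sortedDesc : ∀ {n} a (h : Fin n → ℕ) → sum (map (_∸ a) (sortedDesc h)) ≡ excess a h
sum-∸-sortedDesc {n} a h = begin
  sum (map (_∸ a) (sortedDesc h))
    ≡⟨ sum-↭ (map⁺ (_∸ a) (InsertionSort.sort-↭ (map h (allFin n)))) ⟩
  sum (map (_∸ a) (map h (allFin n)))        ≡⟨ cong sum (map-∘ (allFin n)) ⟨
  sum (map (λ i → h i ∸ a) (allFin n))       ≡⟨ sum-map-allFin (λ i → h i ∸ a) ⟩
  excess a h                                 ∎
  where open ≡-Reasoning

sortedDesc-sorted : ∀ {n} (h : Fin n → ℕ) → AllPairs _≥_ (sortedDesc h)
sortedDesc-sorted {n} h =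
  Linked⇒AllPairs (λ x≥y y≥z → ≤-trans y≥z x≥y) (InsertionSort.sort-↗ (map h (allFin n)))

sum-take-≤ : ∀ xs k a → sum (take k xs) ≤ k * a + sum (map (_∸ a) xs)
sum-take-≤ xs       zero    a = z≤n
sum-take-≤ []       (suc k) a = z≤n
sum-take-≤ (x ∷ xs) (suc k) a = begin
  x + sum (take k xs)                                ≤⟨ +-mono-≤ (m≤n+m∸n x a) (sum-take-≤ xs k a) ⟩
  (a + (x ∸ a)) + (k * a + sum (map (_∸ a) xs))      ≡⟨ interchange a (x ∸ a) (k * a) _ ⟩
  (a + k * a) + ((x ∸ a) + sum (map (_∸ a) xs))      ∎
  where open ≤-Reasoning

-- The first component (a lies below every upper bound of xs) is what makes the induction go through.
sum-take-sorted : ∀ {xs} → AllPairs _≥_ xs → ∀ k →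
                  ∃[ a ] (∀ {y} → All (_≤ y) xs → a ≤ y) × sum (take k xs) ≡ k * a + sum (map (_∸ a) xs)
sum-take-sorted [] k =
  0 , (λ _ → z≤n) , trans (cong sum (take-[] k)) (sym (trans (+-identityʳ (k * 0)) (*-zeroʳ k)))
sum-take-sorted {x ∷ xs} (xs≤x ∷ _) zero =
  x , (λ { (x≤y ∷ _) → x≤y }) , sym (cong₂ _+_ (n∸n≡0 x) (sum-∸-bound xs≤x))
  where
  sum-∸-bound : ∀ {ys} → All (_≤ x) ys → sum (map (_∸ x) ys) ≡ 0
  sum-∸-bound []           = refl
  sum-∸-bound (y≤x ∷ ys≤x) = cong₂ _+_ (m≤n⇒m∸n≡0 y≤x) (sum-∸-bound ys≤x)
sum-take-sorted {x ∷ xs} (xs≤x ∷ sorted) (suc k) with sum-take-sorted sorted k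
... | a , a≤bounds , take≡ = a , (λ { (_ ∷ xs≤y) → a≤bounds xs≤y }) , (begin
  x + sum (take k xs)                                ≡⟨ cong₂ _+_ (sym (m+[n∸m]≡n (a≤bounds xs≤x))) take≡ ⟩
  (a + (x ∸ a)) + (k * a + sum (map (_∸ a) xs))      ≡⟨ interchange a (x ∸ a) (k * a) _ ⟩
  (a + k * a) + ((x ∸ a) + sum (map (_∸ a) xs))      ∎)
  where open ≡-Reasoning

≽⇒Majorizes : ∀ {n} {f g : Fin n → ℕ} → f ≽ g → Majorizes f g
≽⇒Majorizes {f = f} {g} (dominates ∑f≡∑g g≼f) =
  trans (sum-map-allFin f) (trans ∑f≡∑g (sym (sum-map-allFin g))) , Sk-≤
  where
  Sk-≤ : ∀ k → Sk k g ≤ Sk k f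
  Sk-≤ k with sum-take-sorted (sortedDesc-sorted f) k
  ... | a , _ , Skf≡ = begin
    Sk k g                                       ≤⟨ sum-take-≤ (sortedDesc g) k a ⟩
    k * a + sum (map (_∸ a) (sortedDesc g))      ≡⟨ cong (k * a +_) (sum-∸-sortedDesc a g) ⟩
    k * a + excess a g                           ≤⟨ +-monoʳ-≤ (k * a) (g≼f a) ⟩
    k * a + excess a f                           ≡⟨ cong (k * a +_) (sum-∸-sortedDesc a f) ⟨
    k * a + sum (map (_∸ a) (sortedDesc f))      ≡⟨ Skf≡ ⟨
    Sk k f                                       ∎
    where open ≤-Reasoning

-- Schedules

served : ∀ {n} → Maybe (Fin n) → Fin n → ℕ
served nothing  _ = 0
served (just j) i = δ j i

served-≢ : ∀ {n} {i : Fin n} m → m ≢ just i → served m i ≡ 0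
served-≢ nothing  _   = refl
served-≢ (just j) j≢i = δ-≢ (j≢i ∘ cong just)

serve : ∀ {n} → Maybe (Fin n) → (Fin n → ℕ) → Fin n → ℕ
serve m h i = h i ∸ served m i

module _ {n} (σ : ℕ → Maybe (Fin n)) (i : Fin n) where

  countBelow-suc : ∀ t → countBelow σ i (suc t) ≡ served (σ t) i + countBelow σ i t
  countBelow-suc t with σ t
  ... | nothing = refl
  ... | just j with j ≟ i
  ...   | yes refl = cong (_+ countBelow σ j t) (sym (δ-self j))
  ...   | no  j≢i  = cong (_+ countBelow σ i t) (sym (δ-≢ j≢i))

  countBelow-served : ∀ {t} → σ t ≡ just i → countBelow σ i (suc t) ≡ suc (countBelow σ i t)
  countBelow-served {t} σt≡i =
    trans (countBelow-suc t) (cong (_+ countBelow σ i t) (trans (cong (λ m → served m i) σt≡i) (δ-self i)))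

  countBelow-mono : ∀ {s t} → s ≤ t → countBelow σ i s ≤ countBelow σ i t
  countBelow-mono s≤t = go (≤⇒≤′ s≤t)
    where
    go : ∀ {s t} → s ≤′ t → countBelow σ i s ≤ countBelow σ i t
    go ≤′-refl                  = ≤-refl
    go {t = suc t} (≤′-step s≤′t) =
      ≤-trans (go s≤′t) (subst (countBelow σ i t ≤_) (sym (countBelow-suc t)) (m≤n+m _ _))

  countBelow-lastPlusOneBelow : ∀ k → countBelow σ i (lastPlusOneBelow σ i k) ≡ countBelow σ i k
  countBelow-lastPlusOneBelow zero = refl
  countBelow-lastPlusOneBelow (suc k) with σ k in σk≡
  ... | nothing = countBelow-lastPlusOneBelow k
  ... | just j with j ≟ i
  ...   | yes refl = countBelow-served σk≡
  ...   | no  _    = countBelow-lastPlusOneBelow k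

  countBelow-<-lastPlusOneBelow : ∀ {t} k → t < lastPlusOneBelow σ i k → countBelow σ i t < countBelow σ i k
  countBelow-<-lastPlusOneBelow (suc k) t<l with σ k
  ... | nothing = countBelow-<-lastPlusOneBelow k t<l
  ... | just j with j ≟ i
  ...   | yes refl = s≤s (countBelow-mono (≤-pred t<l))
  ...   | no  _    = countBelow-<-lastPlusOneBelow k t<l

module _ {n} {I : Instance n} where
  open Instance I

  arrivals : ℕ → Fin n → ℕ
  arrivals t i with r i ≟ℕ suc t
  ... | yes _ = p i
  ... | no  _ = 0

  arrivals-at : ∀ {i t} → r i ≡ suc t → arrivals t i ≡ p i
  arrivals-at {i} {t} r≡1+t with r i ≟ℕ suc t
  ... | yes _     = refl
  ... | no  r≢1+t = contradiction r≡1+t r≢1+t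

  arrivals-other : ∀ {i t} → r i ≢ suc t → arrivals t i ≡ 0
  arrivals-other {i} {t} r≢1+t with r i ≟ℕ suc t
  ... | yes r≡1+t = contradiction r≡1+t r≢1+t
  ... | no  _     = refl

  module _ (𝒮 : Schedule I) where
    open Schedule 𝒮

    countBelow-before-release : ∀ i {t} → t ≤ r i → countBelow σ i t ≡ 0
    countBelow-before-release i {zero}  _      = refl
    countBelow-before-release i {suc t} t<r = trans (countBelow-suc σ i t)
      (cong₂ _+_ (served-≢ (σ t) (λ σt≡i → <⇒≱ t<r (release t i σt≡i)))
                 (countBelow-before-release i (≤-trans (n≤1+n t) t<r)))

    countBelow-≤-p : ∀ i t → countBelow σ i t ≤ p i
    countBelow-≤-p i t with ≤-total t horizon
    ... | inj₁ t≤h = subst (countBelow σ i t ≤_) (amount i) (countBelow-mono σ i t≤h)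
    ... | inj₂ h≤t = ≤-reflexive (trans (after-horizon (≤⇒≤′ h≤t)) (amount i))
      where
      after-horizon : ∀ {t} → horizon ≤′ t → countBelow σ i t ≡ countBelow σ i horizon
      after-horizon ≤′-refl                    = refl
      after-horizon {suc t} (≤′-step h≤′t) = trans (countBelow-suc σ i t)
        (cong₂ _+_ (cong (λ m → served m i) (idle t (≤′⇒≤ h≤′t))) (after-horizon h≤′t))

    countBelow-after-completion : ∀ i {t} → c 𝒮 i ≤ t → p i ≤ countBelow σ i t
    countBelow-after-completion i {t} c≤t = begin
      p i                                   ≡⟨ amount i ⟨
      countBelow σ i horizon                ≡⟨ countBelow-lastPlusOneBelow σ i horizon ⟨
      countBelow σ i (c 𝒮 i)                ≤⟨ countBelow-mono σ i c≤t ⟩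
      countBelow σ i t                      ∎
      where open ≤-Reasoning

    countBelow-before-completion : ∀ i {t} → t < c 𝒮 i → countBelow σ i t < p i
    countBelow-before-completion i t<c = subst (_ <_) (amount i) (countBelow-<-lastPlusOneBelow σ i horizon t<c)

    -- q 𝒮 t i without reference to the completion time, so that it obeys a slot-by-slot recurrence.
    remaining : ℕ → Fin n → ℕ
    remaining t i with r i ≤? t
    ... | yes _ = p i ∸ countBelow σ i t
    ... | no  _ = 0

    remaining-released : ∀ {i t} → r i ≤ t → remaining t i ≡ p i ∸ countBelow σ i t
    remaining-released {i} {t} r≤t with r i ≤? t
    ... | yes _   = refl
    ... | no  r≰t = contradiction r≤t r≰t

    remaining-unreleased : ∀ {i t} → t < r i → remaining t i ≡ 0
    remaining-unreleased {i} {t} t<r with r i ≤? t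
    ... | yes r≤t = contradiction r≤t (<⇒≱ t<r)
    ... | no  _   = refl

    serve-remaining-unreleased : ∀ {i t} a → t < r i → serve (σ t) (remaining t) i ∸ a ≡ 0
    serve-remaining-unreleased {i} {t} a t<r =
      m≡0⇒m∸n≡0 a (m≡0⇒m∸n≡0 (served (σ t) i) (remaining-unreleased t<r))

    q≗remaining : ∀ t → q 𝒮 t ≗ remaining t
    q≗remaining t i with r i ≤? t | suc t ≤? c 𝒮 i
    ... | yes _ | yes _   = refl
    ... | yes _ | no  t≮c = sym (m≤n⇒m∸n≡0 (countBelow-after-completion i (≮⇒≥ t≮c)))
    ... | no  _ | _       = refl

    active⇒remaining-pos : ∀ {i t} → Active 𝒮 i t → 0 < remaining t i
    active⇒remaining-pos {i} {t} (r≤t , t<c) with r i ≤? t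
    ... | yes _   = m<n⇒0<n∸m (countBelow-before-completion i t<c)
    ... | no  r≰t = contradiction r≤t r≰t

    remaining-pos⇒active : ∀ {i t} → 0 < remaining t i → Active 𝒮 i t
    remaining-pos⇒active {i} {t} pos with r i ≤? t
    ... | no  _   = contradiction pos n≮0
    ... | yes r≤t = r≤t , ≰⇒> c≰t
      where
      c≰t : c 𝒮 i ≰ t
      c≰t c≤t = n≮0 (subst (0 <_) (m≤n⇒m∸n≡0 (countBelow-after-completion i c≤t)) pos)

    served⇒active : ∀ {i t} → σ t ≡ just i → Active 𝒮 i t
    served⇒active {i} {t} σt≡i = release t i σt≡i , ≰⇒> c≰t
      where
      c≰t : c 𝒮 i ≰ t
      c≰t c≤t = <⇒≱ (subst (_≤ p i) (countBelow-served σ i σt≡i) (countBelow-≤-p i (suc t)))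
                    (countBelow-after-completion i c≤t)

    served⇒remaining-pos : ∀ {i t} → σ t ≡ just i → 0 < remaining t i
    served⇒remaining-pos = active⇒remaining-pos ∘ served⇒active

    served⇒∑remaining-pos : ∀ {i t} → σ t ≡ just i → 0 < ∑ (remaining t)
    served⇒∑remaining-pos {i} {t} σt≡i = subst (0 <_) (sym (∑-decrementAt (remaining t) i pos)) z<s
      where pos = active⇒remaining-pos (served⇒active σt≡i)

    idle⇒∑remaining≡0 : WorkConserving 𝒮 → ∀ {t} → σ t ≡ nothing → ∑ (remaining t) ≡ 0
    idle⇒∑remaining≡0 wc {t} σt≡nothing =
      ∑-zero (λ i → n≤0⇒n≡0 (≮⇒≥ (λ pos → wc t (i , remaining-pos⇒active pos) σt≡nothing)))

    remaining-suc-released : ∀ {i t} → r i ≤ t → remaining (suc t) i ≡ serve (σ t) (remaining t) i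
    remaining-suc-released {i} {t} r≤t = begin
      remaining (suc t) i                        ≡⟨ remaining-released (m≤n⇒m≤1+n r≤t) ⟩
      p i ∸ countBelow σ i (suc t)
        ≡⟨ cong (p i ∸_) (trans (countBelow-suc σ i t) (+-comm (served (σ t) i) _)) ⟩
      p i ∸ (countBelow σ i t + served (σ t) i)  ≡⟨ ∸-+-assoc (p i) (countBelow σ i t) (served (σ t) i) ⟨
      p i ∸ countBelow σ i t ∸ served (σ t) i    ≡⟨ cong (_∸ served (σ t) i) (remaining-released r≤t) ⟨
      serve (σ t) (remaining t) i                ∎
      where open ≡-Reasoning

    remaining-suc : ∀ t a i →
      remaining (suc t) i ∸ a ≡ serve (σ t) (remaining t) i ∸ a + (arrivals t i ∸ a)
    remaining-suc t a i with <-cmp (r i) (suc t)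
    ... | tri< r<1+t r≢1+t _ = begin
      remaining (suc t) i ∸ a                               ≡⟨ cong (_∸ a) (remaining-suc-released (≤-pred r<1+t)) ⟩
      serve (σ t) (remaining t) i ∸ a                       ≡⟨ +-identityʳ _ ⟨
      serve (σ t) (remaining t) i ∸ a + 0
        ≡⟨ cong (serve (σ t) (remaining t) i ∸ a +_) (m≡0⇒m∸n≡0 a (arrivals-other r≢1+t)) ⟨
      serve (σ t) (remaining t) i ∸ a + (arrivals t i ∸ a)  ∎
      where open ≡-Reasoning
    ... | tri≈ _ r≡1+t _ = begin
      remaining (suc t) i ∸ a                               ≡⟨ cong (_∸ a) (remaining-released (≤-reflexive r≡1+t)) ⟩
      p i ∸ countBelow σ i (suc t) ∸ a
        ≡⟨ cong (λ k → p i ∸ k ∸ a) (countBelow-before-release i (≤-reflexive (sym r≡1+t))) ⟩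
      p i ∸ a                                               ≡⟨ cong (_∸ a) (arrivals-at r≡1+t) ⟨
      arrivals t i ∸ a
        ≡⟨ cong (_+ (arrivals t i ∸ a)) (serve-remaining-unreleased a (≤-reflexive (sym r≡1+t))) ⟨
      serve (σ t) (remaining t) i ∸ a + (arrivals t i ∸ a)  ∎
      where open ≡-Reasoning
    ... | tri> _ r≢1+t 1+t<r = begin
      remaining (suc t) i ∸ a                               ≡⟨ m≡0⇒m∸n≡0 a (remaining-unreleased 1+t<r) ⟩
      0                                                     ≡⟨ cong₂ _+_ serve-nothing arrive-nothing ⟨
      serve (σ t) (remaining t) i ∸ a + (arrivals t i ∸ a)  ∎
      where
      open ≡-Reasoning
      serve-nothing  = serve-remaining-unreleased a (<-trans (n<1+n t) 1+t<r)
      arrive-nothing = m≡0⇒m∸n≡0 a (arrivals-other r≢1+t)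

    excess-remaining-suc : ∀ t a →
      excess a (remaining (suc t)) ≡ excess a (serve (σ t) (remaining t)) + excess a (arrivals t)
    excess-remaining-suc t a = trans (sum-cong-≗ (remaining-suc t a))
      (∑-distrib-+ (λ i → serve (σ t) (remaining t) i ∸ a) (λ i → arrivals t i ∸ a))

  remaining-zero : ∀ (𝒳 𝒴 : Schedule I) → remaining 𝒳 0 ≗ remaining 𝒴 0
  remaining-zero 𝒳 𝒴 i with r i ≤? 0
  ... | yes _ = refl
  ... | no  _ = refl

module _ {n} {I : Instance n} (srpt 𝒮 : Schedule I) (isSRPT : IsSRPT srpt) (wc : WorkConserving 𝒮) where
  open Schedule srpt using () renaming (σ to σ₁)
  open Schedule 𝒮 using () renaming (σ to σ₂)

  srpt-serves-minimum : ∀ {t j} → σ₁ t ≡ just j →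
                        ∀ k → 0 < remaining srpt t k → remaining srpt t j ≤ remaining srpt t k
  srpt-serves-minimum {t} {j} σ₁t≡j k pos = subst₂ _≤_ (q≗remaining srpt t j) (q≗remaining srpt t k)
    (proj₂ (proj₂ isSRPT t j σ₁t≡j) k (remaining-pos⇒active srpt pos))

  serve-≽ : ∀ t → remaining srpt t ≽ remaining 𝒮 t →
            serve (σ₁ t) (remaining srpt t) ≽ serve (σ₂ t) (remaining 𝒮 t)
  serve-≽ t f≽g with σ₁ t in σ₁t≡ | σ₂ t in σ₂t≡
  ... | nothing | nothing = f≽g
  ... | just j  | just j′ =
    decrementAt-≽ f≽g (srpt-serves-minimum σ₁t≡) (served⇒remaining-pos 𝒮 σ₂t≡)
                  (served⇒remaining-pos srpt σ₁t≡)
  ... | nothing | just j′ = contradiction (subst (0 <_)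
    (trans (sym (∑-≡ f≽g)) (idle⇒∑remaining≡0 srpt (proj₁ isSRPT) σ₁t≡)) (served⇒∑remaining-pos 𝒮 σ₂t≡)) n≮0
  ... | just j  | nothing = contradiction (subst (0 <_)
    (trans (∑-≡ f≽g) (idle⇒∑remaining≡0 𝒮 wc σ₂t≡)) (served⇒∑remaining-pos srpt σ₁t≡)) n≮0

  remaining-≽ : ∀ t → remaining srpt t ≽ remaining 𝒮 t
  remaining-≽ zero    = ≽-resp-≗ (λ _ → refl) (remaining-zero 𝒮 srpt) (dominates refl λ _ → ≤-refl)
  remaining-≽ (suc t) =
    ≽-+-excess (arrivals {I = I} t) (excess-remaining-suc srpt t) (excess-remaining-suc 𝒮 t)
               (serve-≽ t (remaining-≽ t))

lemma6p3 : ∀ {n : ℕ} (I : Instance n) (srpt 𝒮 : Schedule I) →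
           IsSRPT srpt → WorkConserving 𝒮 →
           ∀ (t : ℕ) → Majorizes (q srpt t) (q 𝒮 t)
lemma6p3 I srpt 𝒮 isSRPT wc t =
  ≽⇒Majorizes (≽-resp-≗ (q≗remaining srpt t) (q≗remaining 𝒮 t) (remaining-≽ srpt 𝒮 isSRPT wc t))
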